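{- Let $p$ be an odd prime, $R$ a commutative ring with unity, and $(V,\iota,\epsilon,m,\Delta,(\phi_\alpha)_{\alpha\in\mathbb{U}_p})$ a $\mathbb{U}_p$-extended Frobenius algebra over $R$. Let $\alpha,\beta\in\mathbb{U}_p$ with $\alpha\neq\beta$, and let $r\in\mathbb{Z}_{>0}$ be the largest integer such that $\alpha\beta^{ -1}\in1+p^r\mathbb{Z}_p$. Then \[ m\circ(\phi_\alpha\otimes\phi_\beta)\circ\Delta\circ\iota=\kappa_r \] as maps $R\to V$; in particular this map depends only on $r$.
   Context: $\mathbb{U}_p=1+p\mathbb{Z}_p$. A Frobenius algebra over $R$ is a projective $R$-module $V$ with $R$-linear maps $\iota:R\to V$, $\epsilon:V\to R$, $m:V\otimes_RV\to V$, $\Delta:V\to V\otimes_RV$ satisfying $m(\mathrm{id}\otimes\iota)=\mathrm{id}=m(\iota\otimes\mathrm{id})$, $(\epsilon\otimes\mathrm{id})\Delta=\mathrm{id}=(\mathrm{id}\otimes\epsilon)\Delta$, $m(m\otimes\mathrm{id})=m(\mathrm{id}\otimes m)$, $(\Delta\otimes\mathrm{id})\Delta=(\mathrm{id}\otimes\Delta)\Delta$, $(m\otimes\mathrm{id})(\mathrm{id}\otimes\Delta)=\Delta m=(\mathrm{id}\otimes m)(\Delta\otimes\mathrm{id})$, $m\sigma=m$, $\sigma\Delta=\Delta$ ($\sigma$ the swap). The level of $\alpha\in\mathbb{U}_p$ is the largest $r$ with $\alpha\in1+p^r\mathbb{Z}_p$. A $\mathbb{U}_p$-extended Frobenius algebra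 is a Frobenius algebra with a group homomorphism $\mathbb{U}_p\to\mathrm{Aut}_R(V)$, $\alpha\mapsto\phi_\alpha$, such that: $\phi_\alpha\iota=\iota$; $\epsilon\phi_\alpha=\epsilon$; $\Delta\phi_\alpha=(\phi_\alpha\otimes\phi_\alpha)\Delta$; $\phi_\alpha m=m(\phi_\alpha\otimes\phi_\alpha)$; for each $r\in\mathbb{Z}_{>0}$ the map $m\circ(\phi_\alpha\otimes\mathrm{id}_V)\circ\Delta\circ\iota:R\to V$ is the same for all $\alpha$ of level $r$, and this map is denoted $\kappa_r$; $m\circ(\kappa_r\otimes\kappa_{r'})=m\circ\Delta\circ\kappa_{\min(r,r')}$; and $\phi_\alpha\circ m\circ(\kappa_r\otimes\mathrm{id}_V)=m\circ(\kappa_r\otimes\mathrm{id}_V)$ whenever $\alpha\equiv1\pmod{p^r}$. -}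

module Defs where

open import Level using (Level; _⊔_) renaming (suc to lsuc)
open import Data.Nat as ℕ using (ℕ; zero; suc; _^_; _<_; _%_; NonZero; _⊓_)
open import Data.Nat.Properties using (m^n≢0)
open import Data.Nat.DivMod using (m∣n⇒o%n%m≡o%m; m%n<n; [m+kn]%n≡m%n)
open import Data.Nat.Divisibility using (_∣_; divides)
open import Data.List using (List; []; _∷_; _++_; map; foldr; concatMap)
open import Data.Product using (Σ; _×_; _,_)
open import Relation.Nullary using (¬_)
open import Relation.Binary.PropositionalEquality using (_≡_; refl; trans; cong; sym)
open import Algebra.Bundles using (CommutativeRing)
open import Algebra.Module.Bundles using (Module)

module PAdic (p : ℕ) .{{p≢0 : NonZero p}} where

  _mod^_ : ℕ → ℕ → ℕ
  x mod^ n = _%_ x (p ^ n) {{m^n≢0 p n}}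

  record ℤp : Set where
    field
      res    : ℕ → ℕ
      bound  : ∀ n → res n < p ^ n
      compat : ∀ n → res (suc n) mod^ n ≡ res n
  open ℤp public

  InOnePlus : ℕ → ℤp → Set
  InOnePlus r x = res x r ≡ 1 mod^ r

  record 𝕌p : Set where
    field
      elt  : ℤp
      unit : InOnePlus 1 elt
  open 𝕌p public

  _≈U_ : 𝕌p → 𝕌p → Set
  a ≈U b = ∀ n → res (elt a) n ≡ res (elt b) n

  IsProduct : 𝕌p → 𝕌p → 𝕌p → Set
  IsProduct a b c = ∀ n → res (elt c) n ≡ (res (elt a) n ℕ.* res (elt b) n) mod^ n

  IsOne : 𝕌p → Set
  IsOne a = ∀ n → res (elt a) n ≡ 1 mod^ n

  _≡1mod^_ : 𝕌p → ℕ → Set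
  a ≡1mod^ r = InOnePlus r (elt a)

  HasLevel : 𝕌p → ℕ → Set
  HasLevel a r = InOnePlus r (elt a) × ¬ InOnePlus (suc r) (elt a)

  onePlus : ℕ → 𝕌p
  onePlus k = record
    { elt  = record
        { res    = λ n → (1 ℕ.+ p ^ suc k) mod^ n
        ; bound  = λ n → m%n<n (1 ℕ.+ p ^ suc k) (p ^ n) {{m^n≢0 p n}}
        ; compat = λ n → m∣n⇒o%n%m≡o%m (p ^ n) (p ^ suc n) (1 ℕ.+ p ^ suc k)
                           {{m^n≢0 p n}} {{m^n≢0 p (suc n)}} (divides p refl)
        }
    ; unit = trans (cong (λ z → (1 ℕ.+ z) mod^ 1)
                      (trans (Data.Nat.Properties.*-comm p (p ^ k))
                             (cong (λ z → p ^ k ℕ.* z) (sym (Data.Nat.Properties.*-identityʳ p)))))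
                   ([m+kn]%n≡m%n 1 (p ^ k) (p ^ 1) {{m^n≢0 p 1}})
    }
    where import Data.Nat.Properties

module Lin {c ℓ : Level} (R : CommutativeRing c ℓ) where
  open CommutativeRing R

  record LinearMap {m₁ ℓ₁ m₂ ℓ₂} (M : Module R m₁ ℓ₁) (N : Module R m₂ ℓ₂)
         : Set (c ⊔ m₁ ⊔ ℓ₁ ⊔ m₂ ⊔ ℓ₂) where
    private
      module M = Module M
      module N = Module N
    field
      fun   : M.Carrierᴹ → N.Carrierᴹ
      cong′ : ∀ {x y} → x M.≈ᴹ y → fun x N.≈ᴹ fun y
      +-hom : ∀ x y → fun (x M.+ᴹ y) N.≈ᴹ (fun x N.+ᴹ fun y)
      *-hom : ∀ r x → fun (r M.*ₗ x) N.≈ᴹ (r N.*ₗ fun x)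
  open LinearMap public

  -- projective module: lifting property against surjections
  -- (quantified over modules in the same universe as V)
  IsProjective : ∀ {m ℓm} → Module R m ℓm → Set (c ⊔ ℓ ⊔ lsuc (m ⊔ ℓm))
  IsProjective {m} {ℓm} V =
    (M N : Module R m ℓm) (g : LinearMap M N) →
    (∀ y → Σ (Module.Carrierᴹ M) λ x → Module._≈ᴹ_ N (fun g x) y) →
    (f : LinearMap V N) →
    Σ (LinearMap V M) λ h → ∀ x → Module._≈ᴹ_ N (fun g (fun h x)) (fun f x)

-- Tensor powers V⊗V and V⊗V⊗V of an R-module, as formal sums
-- Σ r_i (x_i ⊗ y_i) modulo the generated R-module congruence
-- (free module on V×V modulo the bilinearity relations).

module Tensor {c ℓ m ℓm : Level} (R : CommutativeRing c ℓ) (V : Module R m ℓm) where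
  open CommutativeRing R
  open Module V

  T2 : Set (c ⊔ m)
  T2 = List (Carrier × Carrierᴹ × Carrierᴹ)

  T3 : Set (c ⊔ m)
  T3 = List (Carrier × Carrierᴹ × Carrierᴹ × Carrierᴹ)

  scale2 : Carrier → T2 → T2
  scale2 s = map (λ { (r , x , y) → (s * r , x , y) })

  scale3 : Carrier → T3 → T3
  scale3 s = map (λ { (r , x , y , z) → (s * r , x , y , z) })

  infix 4 _~₂_ _~₃_
  data _~₂_ : T2 → T2 → Set (c ⊔ ℓ ⊔ m ⊔ ℓm) where
    ~refl  : ∀ {a} → a ~₂ a
    ~sym   : ∀ {a b} → a ~₂ b → b ~₂ a
    ~trans : ∀ {a b d} → a ~₂ b → b ~₂ d → a ~₂ d
    ~++    : ∀ {a a′ b b′} → a ~₂ a′ → b ~₂ b′ → a ++ b ~₂ a′ ++ b′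
    ~comm  : ∀ a b → a ++ b ~₂ b ++ a
    ~scale : ∀ s {a b} → a ~₂ b → scale2 s a ~₂ scale2 s b
    ~elt   : ∀ {r r′ x x′ y y′} → r ≈ r′ → x ≈ᴹ x′ → y ≈ᴹ y′ →
             (r , x , y) ∷ [] ~₂ (r′ , x′ , y′) ∷ []
    ~zero  : ∀ x y → (0# , x , y) ∷ [] ~₂ []
    ~addr  : ∀ r r′ x y → (r + r′ , x , y) ∷ [] ~₂ (r , x , y) ∷ (r′ , x , y) ∷ []
    ~add1  : ∀ r x x′ y → (r , x +ᴹ x′ , y) ∷ [] ~₂ (r , x , y) ∷ (r , x′ , y) ∷ []
    ~add2  : ∀ r x y y′ → (r , x , y +ᴹ y′) ∷ [] ~₂ (r , x , y) ∷ (r , x , y′) ∷ []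
    ~smul1 : ∀ r s x y → (r , s *ₗ x , y) ∷ [] ~₂ (r * s , x , y) ∷ []
    ~smul2 : ∀ r s x y → (r , x , s *ₗ y) ∷ [] ~₂ (r * s , x , y) ∷ []

  data _~₃_ : T3 → T3 → Set (c ⊔ ℓ ⊔ m ⊔ ℓm) where
    ~refl  : ∀ {a} → a ~₃ a
    ~sym   : ∀ {a b} → a ~₃ b → b ~₃ a
    ~trans : ∀ {a b d} → a ~₃ b → b ~₃ d → a ~₃ d
    ~++    : ∀ {a a′ b b′} → a ~₃ a′ → b ~₃ b′ → a ++ b ~₃ a′ ++ b′
    ~comm  : ∀ a b → a ++ b ~₃ b ++ a
    ~scale : ∀ s {a b} → a ~₃ b → scale3 s a ~₃ scale3 s b
    ~elt   : ∀ {r r′ x x′ y y′ z z′} → r ≈ r′ → x ≈ᴹ x′ → y ≈ᴹ y′ → z ≈ᴹ z′ →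
             (r , x , y , z) ∷ [] ~₃ (r′ , x′ , y′ , z′) ∷ []
    ~zero  : ∀ x y z → (0# , x , y , z) ∷ [] ~₃ []
    ~addr  : ∀ r r′ x y z → (r + r′ , x , y , z) ∷ [] ~₃ (r , x , y , z) ∷ (r′ , x , y , z) ∷ []
    ~add1  : ∀ r x x′ y z → (r , x +ᴹ x′ , y , z) ∷ [] ~₃ (r , x , y , z) ∷ (r , x′ , y , z) ∷ []
    ~add2  : ∀ r x y y′ z → (r , x , y +ᴹ y′ , z) ∷ [] ~₃ (r , x , y , z) ∷ (r , x , y′ , z) ∷ []
    ~add3  : ∀ r x y z z′ → (r , x , y , z +ᴹ z′) ∷ [] ~₃ (r , x , y , z) ∷ (r , x , y , z′) ∷ []
    ~smul1 : ∀ r s x y z → (r , s *ₗ x , y , z) ∷ [] ~₃ (r * s , x , y , z) ∷ []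
    ~smul2 : ∀ r s x y z → (r , x , s *ₗ y , z) ∷ [] ~₃ (r * s , x , y , z) ∷ []
    ~smul3 : ∀ r s x y z → (r , x , y , s *ₗ z) ∷ [] ~₃ (r * s , x , y , z) ∷ []

  _⊗_ : Carrierᴹ → Carrierᴹ → T2
  x ⊗ y = (1# , x , y) ∷ []

  _⊗map_ : (Carrierᴹ → Carrierᴹ) → (Carrierᴹ → Carrierᴹ) → T2 → T2
  (f ⊗map g) = map (λ { (r , x , y) → (r , f x , g y) })

  swap : T2 → T2
  swap = map (λ { (r , x , y) → (r , y , x) })

  lift2 : (Carrierᴹ → Carrierᴹ → Carrierᴹ) → T2 → Carrierᴹ
  lift2 μ = foldr (λ { (r , x , y) acc → (r *ₗ μ x y) +ᴹ acc }) 0ᴹ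

  μ⊗id : (Carrierᴹ → Carrierᴹ → Carrierᴹ) → T3 → T2
  μ⊗id μ = map (λ { (r , x , y , z) → (r , μ x y , z) })

  id⊗μ : (Carrierᴹ → Carrierᴹ → Carrierᴹ) → T3 → T2
  id⊗μ μ = map (λ { (r , x , y , z) → (r , x , μ y z) })

  Δ⊗id : (Carrierᴹ → T2) → T2 → T3
  Δ⊗id Δ = concatMap (λ { (r , x , y) → map (λ { (s , u , v) → (r * s , u , v , y) }) (Δ x) })

  id⊗Δ : (Carrierᴹ → T2) → T2 → T3
  id⊗Δ Δ = concatMap (λ { (r , x , y) → map (λ { (s , u , v) → (r * s , x , u , v) }) (Δ y) })

  -- (ε ⊗ id), (id ⊗ ε) : V⊗V → V  (using R⊗V ≅ V ≅ V⊗R)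
  ε⊗id : (Carrierᴹ → Carrier) → T2 → Carrierᴹ
  ε⊗id ε = foldr (λ { (r , x , y) acc → ((r * ε x) *ₗ y) +ᴹ acc }) 0ᴹ

  id⊗ε : (Carrierᴹ → Carrier) → T2 → Carrierᴹ
  id⊗ε ε = foldr (λ { (r , x , y) acc → ((r * ε y) *ₗ x) +ᴹ acc }) 0ᴹ

module Frobenius {c ℓ m ℓm : Level} (R : CommutativeRing c ℓ) (V : Module R m ℓm) where
  open CommutativeRing R
  open Module V
  open Tensor R V
  open Lin R using (IsProjective)

  record FrobeniusAlgebra : Set (c ⊔ ℓ ⊔ lsuc (m ⊔ ℓm)) where
    field
      projective : IsProjective V
      ι       : Carrier → Carrierᴹ
      ι-cong  : ∀ {r s} → r ≈ s → ι r ≈ᴹ ι s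
      ι-+     : ∀ r s → ι (r + s) ≈ᴹ ι r +ᴹ ι s
      ι-*     : ∀ r s → ι (r * s) ≈ᴹ r *ₗ ι s
      ε       : Carrierᴹ → Carrier
      ε-cong  : ∀ {x y} → x ≈ᴹ y → ε x ≈ ε y
      ε-+     : ∀ x y → ε (x +ᴹ y) ≈ ε x + ε y
      ε-*     : ∀ r x → ε (r *ₗ x) ≈ r * ε x
      -- multiplication m : V⊗V → V, given by the bilinear map μ (m = lift2 μ)
      μ       : Carrierᴹ → Carrierᴹ → Carrierᴹ
      μ-cong  : ∀ {x x′ y y′} → x ≈ᴹ x′ → y ≈ᴹ y′ → μ x y ≈ᴹ μ x′ y′
      μ-+ˡ    : ∀ x x′ y → μ (x +ᴹ x′) y ≈ᴹ μ x y +ᴹ μ x′ y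
      μ-+ʳ    : ∀ x y y′ → μ x (y +ᴹ y′) ≈ᴹ μ x y +ᴹ μ x y′
      μ-*ˡ    : ∀ r x y → μ (r *ₗ x) y ≈ᴹ r *ₗ μ x y
      μ-*ʳ    : ∀ r x y → μ x (r *ₗ y) ≈ᴹ r *ₗ μ x y
      Δ       : Carrierᴹ → T2
      Δ-cong  : ∀ {x y} → x ≈ᴹ y → Δ x ~₂ Δ y
      Δ-+     : ∀ x y → Δ (x +ᴹ y) ~₂ Δ x ++ Δ y
      Δ-*     : ∀ r x → Δ (r *ₗ x) ~₂ scale2 r (Δ x)
      unitʳ   : ∀ x → lift2 μ (x ⊗ ι 1#) ≈ᴹ x
      unitˡ   : ∀ x → lift2 μ (ι 1# ⊗ x) ≈ᴹ x
      counitˡ : ∀ x → ε⊗id ε (Δ x) ≈ᴹ x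
      counitʳ : ∀ x → id⊗ε ε (Δ x) ≈ᴹ x
      assoc   : ∀ t → lift2 μ (μ⊗id μ t) ≈ᴹ lift2 μ (id⊗μ μ t)
      coassoc : ∀ x → Δ⊗id Δ (Δ x) ~₃ id⊗Δ Δ (Δ x)
      frobˡ   : ∀ t → μ⊗id μ (id⊗Δ Δ t) ~₂ Δ (lift2 μ t)
      frobʳ   : ∀ t → id⊗μ μ (Δ⊗id Δ t) ~₂ Δ (lift2 μ t)
      comm    : ∀ t → lift2 μ (swap t) ≈ᴹ lift2 μ t
      cocomm  : ∀ x → swap (Δ x) ~₂ Δ x

module Extended (p : ℕ) .{{_ : NonZero p}}
                {c ℓ m ℓm : Level} (R : CommutativeRing c ℓ) (V : Module R m ℓm) where
  open PAdic p
  open CommutativeRing R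
  open Module V
  open Tensor R V
  open Frobenius R V

  module _ (F : FrobeniusAlgebra) where
    open FrobeniusAlgebra F

    mφψΔι : (Carrierᴹ → Carrierᴹ) → (Carrierᴹ → Carrierᴹ) → Carrier → Carrierᴹ
    mφψΔι φ ψ s = lift2 μ ((φ ⊗map ψ) (Δ (ι s)))

    -- κ_{k+1} := m ∘ (φ_α ⊗ id) ∘ Δ ∘ ι for the level-(k+1) element α = 1 + p^(k+1)
    κ[_] : (𝕌p → Carrierᴹ → Carrierᴹ) → ℕ → Carrier → Carrierᴹ
    κ[ φ ] k = mφψΔι (φ (onePlus k)) (λ x → x)

  record UpExtended (F : FrobeniusAlgebra) : Set (c ⊔ ℓ ⊔ lsuc (m ⊔ ℓm)) where
    open FrobeniusAlgebra F
    field
      φ        : 𝕌p → Carrierᴹ → Carrierᴹ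
      φ-cong   : ∀ α {x y} → x ≈ᴹ y → φ α x ≈ᴹ φ α y
      φ-+      : ∀ α x y → φ α (x +ᴹ y) ≈ᴹ φ α x +ᴹ φ α y
      φ-*      : ∀ α r x → φ α (r *ₗ x) ≈ᴹ r *ₗ φ α x
      φ-bij    : ∀ α → Σ (Carrierᴹ → Carrierᴹ) λ g →
                   (∀ x → g (φ α x) ≈ᴹ x) × (∀ x → φ α (g x) ≈ᴹ x)
      φ-one    : ∀ α → IsOne α → ∀ x → φ α x ≈ᴹ x
      φ-mul    : ∀ α β γ → IsProduct α β γ → ∀ x → φ γ x ≈ᴹ φ α (φ β x)
      φ-ι      : ∀ α s → φ α (ι s) ≈ᴹ ι s
      ε-φ      : ∀ α x → ε (φ α x) ≈ ε x
      Δ-φ      : ∀ α x → Δ (φ α x) ~₂ (φ α ⊗map φ α) (Δ x)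
      φ-m      : ∀ α t → φ α (lift2 μ t) ≈ᴹ lift2 μ ((φ α ⊗map φ α) t)
      κ-welldef : ∀ r → 0 < r → ∀ α α′ → HasLevel α r → HasLevel α′ r →
                  ∀ s → mφψΔι F (φ α) (λ x → x) s ≈ᴹ mφψΔι F (φ α′) (λ x → x) s
      -- m (κ_r ⊗ κ_r′) = m Δ κ_min(r,r′)   (R⊗R ≅ R)
      κ-mul    : ∀ k k′ s → lift2 μ ((s , κ[_] F φ k 1# , κ[_] F φ k′ 1#) ∷ [])
                             ≈ᴹ lift2 μ (Δ (κ[_] F φ (k ⊓ k′) s))
      -- φ_α m (κ_r ⊗ id) = m (κ_r ⊗ id) when α ≡ 1 mod p^r   (R⊗V ≅ V)
      κ-fix    : ∀ k α → α ≡1mod^ (suc k) → ∀ x →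
                  φ α (lift2 μ (κ[_] F φ k 1# ⊗ x)) ≈ᴹ lift2 μ (κ[_] F φ k 1# ⊗ x)

{-# OPTIONS --safe #-}

-- Write γ = αβ⁻¹, so that φ_α = φ_γ φ_β. Since φ_β fixes ι and commutes with Δ,
--   m (φ_α ⊗ φ_β) Δ ι = m (φ_γ ⊗ id) (φ_β ⊗ φ_β) Δ ι = m (φ_γ ⊗ id) Δ φ_β ι = m (φ_γ ⊗ id) Δ ι,
-- and the right-hand side is κ_r because γ has level r, like the reference element 1 + p^r.

module Submission where

open import Defs
open import Level using (Level; _⊔_)
open import Data.Nat using (ℕ; suc; NonZero)
open import Data.Nat.Divisibility using (_∣_)
open import Data.Nat.Primality using (Prime)
open import Relation.Nullary using (¬_)
open import Algebra.Bundles using (CommutativeRing)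
open import Algebra.Module.Bundles using (Module)

open import Data.Nat using (_<_; s≤s; z≤n; nonTrivial⇒n>1)
open import Data.Nat.Primality using (prime⇒nonTrivial)
open import Function using (id)
open import Data.List using ([]; _∷_; _++_)
open import Data.Product using (_,_)
open import Relation.Binary.PropositionalEquality using (_≡_; refl; cong; sym; module ≡-Reasoning)
import Relation.Binary.Reasoning.Setoid as SetoidReasoning

module PAdicLevel where
  open import Data.Nat using (_+_; _*_; _^_; s≤s; z≤n; ≢-nonZero⁻¹)
  open import Data.Nat.Properties
    using (+-monoˡ-<; +-identityʳ; *-monoˡ-≤; ^-monoʳ-<; m^n≢0; suc-injective; module ≤-Reasoning)
  open import Data.Nat.DivMod using ([m+n]%n≡m%n; m<n⇒m%n≡m)

  1+n<m*n : ∀ {m n} → 1 < m → 1 < n → 1 + n < m * n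
  1+n<m*n {m} {n} 1<m 1<n = begin-strict
    1 + n     <⟨ +-monoˡ-< n 1<n ⟩
    n + n     ≡⟨ cong (n +_) (sym (+-identityʳ n)) ⟩
    2 * n     ≤⟨ *-monoˡ-≤ n 1<m ⟩
    m * n     ∎
    where open ≤-Reasoning

  module _ (p : ℕ) .{{_ : NonZero p}} where
    open PAdic p

    onePlus-hasLevel : 1 < p → ∀ k → HasLevel (onePlus k) (suc k)
    onePlus-hasLevel 1<p k = [m+n]%n≡m%n 1 q {{m^n≢0 p (suc k)}} , notInNextLevel
      where
      q : ℕ
      q = p ^ suc k

      1<q : 1 < q
      1<q = ^-monoʳ-< p 1<p {0} {suc k} (s≤s z≤n)

      notInNextLevel : ¬ InOnePlus (suc (suc k)) (elt (onePlus k))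
      notInNextLevel 1+q≡1 = ≢-nonZero⁻¹ q {{m^n≢0 p (suc k)}} (suc-injective (begin
        1 + q                ≡⟨ m<n⇒m%n≡m {{m^n≢0 p (suc (suc k))}} (1+n<m*n 1<p 1<q) ⟨
        (1 + q) mod^ (2 + k) ≡⟨ 1+q≡1 ⟩
        1 mod^ (2 + k)       ≡⟨ m<n⇒m%n≡m {{m^n≢0 p (suc (suc k))}} (^-monoʳ-< p 1<p {0} {2 + k} (s≤s z≤n)) ⟩
        1                    ∎))
        where open ≡-Reasoning

open PAdicLevel using (onePlus-hasLevel)

module _ {c ℓ m ℓm : Level} (R : CommutativeRing c ℓ) (V : Module R m ℓm) where
  open CommutativeRing R using (_*_)
  open Module V
  open Tensor R V
  open Lin R using (LinearMap; fun; cong′; +-hom; *-hom)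
  open SetoidReasoning ≈ᴹ-setoid

  record IsBilinear (ν : Carrierᴹ → Carrierᴹ → Carrierᴹ) : Set (c ⊔ m ⊔ ℓm) where
    field
      cong₂  : ∀ {x x′ y y′} → x ≈ᴹ x′ → y ≈ᴹ y′ → ν x y ≈ᴹ ν x′ y′
      +-homˡ : ∀ x x′ y → ν (x +ᴹ x′) y ≈ᴹ ν x y +ᴹ ν x′ y
      +-homʳ : ∀ x y y′ → ν x (y +ᴹ y′) ≈ᴹ ν x y +ᴹ ν x y′
      *-homˡ : ∀ r x y → ν (r *ₗ x) y ≈ᴹ r *ₗ ν x y
      *-homʳ : ∀ r x y → ν x (r *ₗ y) ≈ᴹ r *ₗ ν x y

  precomposeˡ-isBilinear : ∀ {ν} → IsBilinear ν → (f : LinearMap V V) →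
                           IsBilinear (λ x y → ν (fun f x) y)
  precomposeˡ-isBilinear ν-bilinear f = record
    { cong₂  = λ x≈x′ y≈y′ → B.cong₂ (cong′ f x≈x′) y≈y′
    ; +-homˡ = λ x x′ y → ≈ᴹ-trans (B.cong₂ (+-hom f x x′) ≈ᴹ-refl) (B.+-homˡ _ _ y)
    ; +-homʳ = λ x → B.+-homʳ (fun f x)
    ; *-homˡ = λ r x y → ≈ᴹ-trans (B.cong₂ (*-hom f r x) ≈ᴹ-refl) (B.*-homˡ r _ y)
    ; *-homʳ = λ r x → B.*-homʳ r (fun f x)
    }
    where module B = IsBilinear ν-bilinear

  module _ {ν : Carrierᴹ → Carrierᴹ → Carrierᴹ} where

    lift2-++ : ∀ a b → lift2 ν (a ++ b) ≈ᴹ lift2 ν a +ᴹ lift2 ν b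
    lift2-++ []                b = ≈ᴹ-sym (+ᴹ-identityˡ _)
    lift2-++ ((r , x , y) ∷ a) b = begin
      r *ₗ ν x y +ᴹ lift2 ν (a ++ b)            ≈⟨ +ᴹ-congˡ (lift2-++ a b) ⟩
      r *ₗ ν x y +ᴹ (lift2 ν a +ᴹ lift2 ν b)    ≈⟨ +ᴹ-assoc _ _ _ ⟨
      (r *ₗ ν x y +ᴹ lift2 ν a) +ᴹ lift2 ν b    ∎

    lift2-scale2 : ∀ s a → lift2 ν (scale2 s a) ≈ᴹ s *ₗ lift2 ν a
    lift2-scale2 s []                = ≈ᴹ-sym (*ₗ-zeroʳ s)
    lift2-scale2 s ((r , x , y) ∷ a) = begin
      (s * r) *ₗ ν x y +ᴹ lift2 ν (scale2 s a)  ≈⟨ +ᴹ-cong (*ₗ-assoc s r _) (lift2-scale2 s a) ⟩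
      s *ₗ (r *ₗ ν x y) +ᴹ s *ₗ lift2 ν a       ≈⟨ *ₗ-distribˡ s _ _ ⟨
      s *ₗ (r *ₗ ν x y +ᴹ lift2 ν a)            ∎

    lift2-⊗map : ∀ f g t → lift2 ν ((f ⊗map g) t) ≡ lift2 (λ x y → ν (f x) (g y)) t
    lift2-⊗map f g []                = refl
    lift2-⊗map f g ((r , x , y) ∷ t) = cong (r *ₗ ν (f x) (g y) +ᴹ_) (lift2-⊗map f g t)

  module _ {ν : Carrierᴹ → Carrierᴹ → Carrierᴹ} (ν-bilinear : IsBilinear ν) where
    open IsBilinear ν-bilinear

    private
      splits : ∀ {r x y r₁ x₁ y₁ r₂ x₂ y₂} → r *ₗ ν x y ≈ᴹ r₁ *ₗ ν x₁ y₁ +ᴹ r₂ *ₗ ν x₂ y₂ →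
               lift2 ν ((r , x , y) ∷ []) ≈ᴹ lift2 ν ((r₁ , x₁ , y₁) ∷ (r₂ , x₂ , y₂) ∷ [])
      splits e = ≈ᴹ-trans (+ᴹ-congʳ e) (+ᴹ-assoc _ _ _)

    lift2-resp-~₂ : ∀ {a b} → a ~₂ b → lift2 ν a ≈ᴹ lift2 ν b
    lift2-resp-~₂ ~refl         = ≈ᴹ-refl
    lift2-resp-~₂ (~sym e)      = ≈ᴹ-sym (lift2-resp-~₂ e)
    lift2-resp-~₂ (~trans e f)  = ≈ᴹ-trans (lift2-resp-~₂ e) (lift2-resp-~₂ f)
    lift2-resp-~₂ (~++ {a} {a′} {b} {b′} e f) = begin
      lift2 ν (a ++ b)            ≈⟨ lift2-++ a b ⟩
      lift2 ν a +ᴹ lift2 ν b      ≈⟨ +ᴹ-cong (lift2-resp-~₂ e) (lift2-resp-~₂ f) ⟩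
      lift2 ν a′ +ᴹ lift2 ν b′    ≈⟨ lift2-++ a′ b′ ⟨
      lift2 ν (a′ ++ b′)          ∎
    lift2-resp-~₂ (~comm a b) = begin
      lift2 ν (a ++ b)            ≈⟨ lift2-++ a b ⟩
      lift2 ν a +ᴹ lift2 ν b      ≈⟨ +ᴹ-comm _ _ ⟩
      lift2 ν b +ᴹ lift2 ν a      ≈⟨ lift2-++ b a ⟨
      lift2 ν (b ++ a)            ∎
    lift2-resp-~₂ (~scale s {a} {b} e) = begin
      lift2 ν (scale2 s a)        ≈⟨ lift2-scale2 s a ⟩
      s *ₗ lift2 ν a              ≈⟨ *ₗ-congˡ (lift2-resp-~₂ e) ⟩
      s *ₗ lift2 ν b              ≈⟨ lift2-scale2 s b ⟨
      lift2 ν (scale2 s b)        ∎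
    lift2-resp-~₂ (~elt r≈r′ x≈x′ y≈y′) = +ᴹ-congʳ (*ₗ-cong r≈r′ (cong₂ x≈x′ y≈y′))
    lift2-resp-~₂ (~zero x y)           = ≈ᴹ-trans (+ᴹ-congʳ (*ₗ-zeroˡ _)) (+ᴹ-identityˡ _)
    lift2-resp-~₂ (~addr r r′ x y)      = splits (*ₗ-distribʳ _ r r′)
    lift2-resp-~₂ (~add1 r x x′ y)      = splits (≈ᴹ-trans (*ₗ-congˡ (+-homˡ x x′ y)) (*ₗ-distribˡ r _ _))
    lift2-resp-~₂ (~add2 r x y y′)      = splits (≈ᴹ-trans (*ₗ-congˡ (+-homʳ x y y′)) (*ₗ-distribˡ r _ _))
    lift2-resp-~₂ (~smul1 r s x y)      = +ᴹ-congʳ (≈ᴹ-trans (*ₗ-congˡ (*-homˡ s x y)) (≈ᴹ-sym (*ₗ-assoc r s _)))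
    lift2-resp-~₂ (~smul2 r s x y)      = +ᴹ-congʳ (≈ᴹ-trans (*ₗ-congˡ (*-homʳ s x y)) (≈ᴹ-sym (*ₗ-assoc r s _)))

  lift2-pointwise : ∀ {ν ν′} → (∀ x y → ν x y ≈ᴹ ν′ x y) → ∀ t → lift2 ν t ≈ᴹ lift2 ν′ t
  lift2-pointwise ν≈ν′ []                = ≈ᴹ-refl
  lift2-pointwise ν≈ν′ ((r , x , y) ∷ t) = +ᴹ-cong (*ₗ-congˡ (ν≈ν′ x y)) (lift2-pointwise ν≈ν′ t)

module _ {c ℓ m ℓm : Level} {R : CommutativeRing c ℓ} {V : Module R m ℓm}
         (F : Frobenius.FrobeniusAlgebra R V) where
  open Frobenius.FrobeniusAlgebra F

  μ-isBilinear : IsBilinear R V μ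
  μ-isBilinear = record
    { cong₂ = μ-cong ; +-homˡ = μ-+ˡ ; +-homʳ = μ-+ʳ ; *-homˡ = μ-*ˡ ; *-homʳ = μ-*ʳ }

module _ (p : ℕ) .{{_ : NonZero p}} {c ℓ m ℓm : Level} {R : CommutativeRing c ℓ}
         {V : Module R m ℓm} {F : Frobenius.FrobeniusAlgebra R V}
         (E : Extended.UpExtended p R V F) where
  open Module V
  open Tensor R V
  open Lin R using (LinearMap)
  open Frobenius.FrobeniusAlgebra F
  open Extended p R V
  open UpExtended E
  open PAdic p
  open SetoidReasoning ≈ᴹ-setoid

  φ-linear : 𝕌p → LinearMap V V
  φ-linear α = record { fun = φ α ; cong′ = φ-cong α ; +-hom = φ-+ α ; *-hom = φ-* α }

  mφψΔι-product : ∀ {α β γ} → IsProduct γ β α →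
                  ∀ s → mφψΔι F (φ α) (φ β) s ≈ᴹ mφψΔι F (φ γ) id s
  mφψΔι-product {α} {β} {γ} α≡γβ s = begin
    lift2 μ ((φ α ⊗map φ β) (Δ (ι s)))             ≡⟨ lift2-⊗map R V (φ α) (φ β) (Δ (ι s)) ⟩
    lift2 (λ x y → μ (φ α x) (φ β y)) (Δ (ι s))     ≈⟨ lift2-pointwise R V φα≈φγφβ (Δ (ι s)) ⟩
    lift2 (λ x y → ν (φ β x) (φ β y)) (Δ (ι s))     ≡⟨ lift2-⊗map R V (φ β) (φ β) (Δ (ι s)) ⟨
    lift2 ν ((φ β ⊗map φ β) (Δ (ι s)))              ≈⟨ lift2-resp-~₂ R V ν-bilinear (~sym (Δ-φ β (ι s))) ⟩
    lift2 ν (Δ (φ β (ι s)))                         ≈⟨ lift2-resp-~₂ R V ν-bilinear (Δ-cong (φ-ι β s)) ⟩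
    lift2 ν (Δ (ι s))                               ≡⟨ lift2-⊗map R V (φ γ) id (Δ (ι s)) ⟨
    lift2 μ ((φ γ ⊗map id) (Δ (ι s)))               ∎
    where
    ν : Carrierᴹ → Carrierᴹ → Carrierᴹ
    ν x y = μ (φ γ x) y

    ν-bilinear : IsBilinear R V ν
    ν-bilinear = precomposeˡ-isBilinear R V (μ-isBilinear F) (φ-linear γ)

    φα≈φγφβ : ∀ x y → μ (φ α x) (φ β y) ≈ᴹ ν (φ β x) (φ β y)
    φα≈φγφβ x y = μ-cong (φ-mul γ β α α≡γβ x) ≈ᴹ-refl

  mφidΔι-hasLevel : 1 < p → ∀ {γ} k → HasLevel γ (suc k) → ∀ s → mφψΔι F (φ γ) id s ≈ᴹ κ[_] F φ k s
  mφidΔι-hasLevel 1<p {γ} k γ-level =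
    κ-welldef (suc k) (s≤s z≤n) γ (onePlus k) γ-level (onePlus-hasLevel p 1<p k)

proposition3p25 : ∀ {c ℓ m ℓm : Level} (p : ℕ) .{{_ : NonZero p}} → Prime p → ¬ (2 ∣ p) →
    (R : CommutativeRing c ℓ) (V : Module R m ℓm) →
    (F : Frobenius.FrobeniusAlgebra R V) (E : Extended.UpExtended p R V F) →
    (α β γ : PAdic.𝕌p p) → ¬ (PAdic._≈U_ p α β) → PAdic.IsProduct p γ β α →
    (k : ℕ) → PAdic.HasLevel p γ (suc k) →
    ∀ s → Module._≈ᴹ_ V
            (Extended.mφψΔι p R V F (Extended.UpExtended.φ E α) (Extended.UpExtended.φ E β) s)
            (Extended.κ[_] p R V F (Extended.UpExtended.φ E) k s)
proposition3p25 p p-prime _ R V F E α β γ _ α≡γβ k γ-level s =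
  Module.≈ᴹ-trans V (mφψΔι-product p E {γ = γ} α≡γβ s) (mφidΔι-hasLevel p E 1<p k γ-level s)
  where
  -- Primality enters only through p > 1.
  1<p : 1 < p
  1<p = nonTrivial⇒n>1 p {{prime⇒nonTrivial p-prime}}
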